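{- Let $\Delta,\Gamma$ be arbitrary contexts (both possibly containing locks), $A$ an arbitrary type, and $t:\Delta\mathbin{+\!\!+}\Gamma\vdash A$ a term of IKC (respectively IS4C) in the concatenated context that does not mention any variables from $\Delta$. Then there is a term $t':\Gamma\vdash A$ of IKC (respectively IS4C).
   Context: Types $A,B::=\iota\mid A\Rightarrow B\mid\Box A$; contexts $\Gamma::=\cdot\mid\Gamma,A\mid\Gamma,\blacksquare$ (snoc lists; $\blacksquare$ a lock); $\Delta\mathbin{+\!\!+}\Gamma$ is concatenation ($\Delta\mathbin{+\!\!+}\cdot=\Delta$, $\Delta\mathbin{+\!\!+}(\Gamma,X)=(\Delta\mathbin{+\!\!+}\Gamma),X$). Terms of both calculi: de Bruijn variables ($\mathsf{zero}:(\Gamma,A)\vdash_{var}A$, $\mathsf{succ}\,v:(\Gamma,B)\vdash_{var}A$ for $v:\Gamma\vdash_{var}A$; no variable passes a lock), $\lambda$-abstraction, application, $\Gamma\vdash\mathsf{box}\,t:\Box A$ for $(\Gamma,\blacksquare)\vdash t:A$, and $\Gamma\vdash\mathsf{unbox}(t,e):A$ for $\Delta'\vdash t:\Box A$ and $e:\Delta'\lhd\Gamma$. In IKC, $\lhd$ is generated by $\mathsf{nil}:\Gamma\lhd(\Gamma,\blacksquare)$ and $\mathsf{ext}\,e:\Delta\lhd(\Gamma,A)$ for $e:\Delta\lhd\Gamma$. In IS4C, by $\mathsf{nil}:\Gamma\lhd\Gamma$, $\mathsf{ext}\,e:\Delta\lhd(\Gamma,A)$ and $\mathsf{lock}\,e:\Delta\lhd(\Gamma,\blacksquare)$.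 A term in context $\Delta\mathbin{+\!\!+}\Gamma$ "mentions a variable from $\Delta$" if some variable occurrence in it, resolved through the binders and context changes ($\lambda$, $\mathsf{box}$, $\mathsf{unbox}$) inside the term, refers to a type declared in the prefix $\Delta$. -}

module Defs where

open import Data.Bool using (Bool; true; false)
open import Data.Product using (_×_)

data Ty : Set where
  ι   : Ty
  _⇒_ : Ty → Ty → Ty
  □_  : Ty → Ty

infixr 7 _⇒_
infixl 5 _,_ _,■

data Ctx : Set where
  ·   : Ctx
  _,_ : Ctx → Ty → Ctx
  _,■ : Ctx → Ctx

infixl 4 _++_
_++_ : Ctx → Ctx → Ctx
Δ ++ ·       = Δ
Δ ++ (Γ , A) = (Δ ++ Γ) , A
Δ ++ (Γ ,■)  = (Δ ++ Γ) ,■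

data Var : Ctx → Ty → Set where
  zero : ∀ {Γ A} → Var (Γ , A) A
  succ : ∀ {Γ A B} → Var Γ A → Var (Γ , B) A

data _◁K_ : Ctx → Ctx → Set where
  nil : ∀ {Γ} → Γ ◁K (Γ ,■)
  ext : ∀ {Δ Γ A} → Δ ◁K Γ → Δ ◁K (Γ , A)

data _◁S_ : Ctx → Ctx → Set where
  nil  : ∀ {Γ} → Γ ◁S Γ
  ext  : ∀ {Δ Γ A} → Δ ◁S Γ → Δ ◁S (Γ , A)
  lock : ∀ {Δ Γ} → Δ ◁S Γ → Δ ◁S (Γ ,■)

module Terms (_◁_ : Ctx → Ctx → Set) where
  data Tm : Ctx → Ty → Set where
    var   : ∀ {Γ A} → Var Γ A → Tm Γ A
    lam   : ∀ {Γ A B} → Tm (Γ , A) B → Tm Γ (A ⇒ B)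
    app   : ∀ {Γ A B} → Tm Γ (A ⇒ B) → Tm Γ A → Tm Γ B
    box   : ∀ {Γ A} → Tm (Γ ,■) A → Tm Γ (□ A)
    unbox : ∀ {Γ Δ' A} → Tm Δ' (□ A) → Δ' ◁ Γ → Tm Γ A

TmK : Ctx → Ty → Set
TmK = Terms.Tm _◁K_

TmS : Ctx → Ty → Set
TmS = Terms.Tm _◁S_

-- Marking of a context: each type entry is flagged `true` (forbidden,
-- i.e. declared in the prefix Δ) or `false` (allowed).
data Mark : Ctx → Set where
  []    : Mark ·
  _∷ty_ : ∀ {Γ A} → Mark Γ → Bool → Mark (Γ , A)
  _∷■   : ∀ {Γ} → Mark Γ → Mark (Γ ,■)

uniform : Bool → (Γ : Ctx) → Mark Γ
uniform b ·       = []
uniform b (Γ , A) = uniform b Γ ∷ty b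
uniform b (Γ ,■)  = uniform b Γ ∷■

split : (Δ Γ : Ctx) → Mark (Δ ++ Γ)
split Δ ·       = uniform true Δ
split Δ (Γ , A) = split Δ Γ ∷ty false
split Δ (Γ ,■)  = split Δ Γ ∷■

data VarOK : ∀ {Γ A} → Mark Γ → Var Γ A → Set where
  zero : ∀ {Γ A} {m : Mark Γ} → VarOK {Γ , A} (m ∷ty false) zero
  succ : ∀ {Γ A B} {m : Mark Γ} {b} {v : Var Γ A} →
         VarOK m v → VarOK {Γ , B} (m ∷ty b) (succ v)

restrictK : ∀ {Δ Γ} → Δ ◁K Γ → Mark Γ → Mark Δ
restrictK nil     (m ∷■)    = m
restrictK (ext e) (m ∷ty b) = restrictK e m

restrictS : ∀ {Δ Γ} → Δ ◁S Γ → Mark Γ → Mark Δ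
restrictS nil      m         = m
restrictS (ext e)  (m ∷ty b) = restrictS e m
restrictS (lock e) (m ∷■)    = restrictS e m

module Avoid (_◁_ : Ctx → Ctx → Set)
             (restrict : ∀ {Δ Γ} → Δ ◁ Γ → Mark Γ → Mark Δ) where
  open Terms _◁_
  data OK : ∀ {Γ A} → Mark Γ → Tm Γ A → Set where
    var   : ∀ {Γ A} {m : Mark Γ} {v : Var Γ A} → VarOK m v → OK m (var v)
    lam   : ∀ {Γ A B} {m : Mark Γ} {t : Tm (Γ , A) B} →
            OK (m ∷ty false) t → OK m (lam t)
    app   : ∀ {Γ A B} {m : Mark Γ} {t : Tm Γ (A ⇒ B)} {u : Tm Γ A} →
            OK m t → OK m u → OK m (app t u)
    box   : ∀ {Γ A} {m : Mark Γ} {t : Tm (Γ ,■) A} →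
            OK (m ∷■) t → OK m (box t)
    unbox : ∀ {Γ Δ' A} {m : Mark Γ} {t : Tm Δ' (□ A)} {e : Δ' ◁ Γ} →
            OK (restrict e m) t → OK m (unbox t e)

NoMentionK : (Δ Γ : Ctx) {A : Ty} → TmK (Δ ++ Γ) A → Set
NoMentionK Δ Γ t = Avoid.OK _◁K_ restrictK (split Δ Γ) t

NoMentionS : (Δ Γ : Ctx) {A : Ty} → TmS (Δ ++ Γ) A → Set
NoMentionS Δ Γ t = Avoid.OK _◁S_ restrictS (split Δ Γ) t

{-# OPTIONS --safe #-}
module Submission where

open import Defs
open import Data.Bool using (true; false)
open import Data.Product using (_×_; ∃-syntax) renaming (_,_ to _&_)
open import Data.Unit using (⊤; tt)

-- Normalisation by evaluation in a Kripke model whose worlds are contexts.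
-- Evaluate t in the environment over Δ ++ Γ at world Γ that reflects the
-- variables of Γ and gives the variables of Δ no value at all; each lock of Δ
-- is interpreted by a "virtual" accessibility from the empty world, which is
-- harmless because t never looks up a variable of Δ. Reflection of neutral
-- terms only happens in non-empty worlds, from which the empty world (hence a
-- virtual accessibility) is unreachable, so reifying the value gives a term in Γ.

data _⊆_ : Ctx → Ctx → Set where
  base  : · ⊆ ·
  drop  : ∀ {Γ Δ A} → Γ ⊆ Δ → Γ ⊆ (Δ , A)
  keep  : ∀ {Γ Δ A} → Γ ⊆ Δ → (Γ , A) ⊆ (Δ , A)
  keep■ : ∀ {Γ Δ} → Γ ⊆ Δ → (Γ ,■) ⊆ (Δ ,■)

⊆-refl : ∀ {Γ} → Γ ⊆ Γ
⊆-refl {·}     = base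
⊆-refl {Γ , A} = keep ⊆-refl
⊆-refl {Γ ,■}  = keep■ ⊆-refl

⊆-trans : ∀ {Γ Δ Θ} → Γ ⊆ Δ → Δ ⊆ Θ → Γ ⊆ Θ
⊆-trans o         base      = o
⊆-trans o         (drop p)  = drop (⊆-trans o p)
⊆-trans (drop o)  (keep p)  = drop (⊆-trans o p)
⊆-trans (keep o)  (keep p)  = keep (⊆-trans o p)
⊆-trans (keep■ o) (keep■ p) = keep■ (⊆-trans o p)

renameVar : ∀ {Γ Δ A} → Γ ⊆ Δ → Var Γ A → Var Δ A
renameVar (drop o) v        = succ (renameVar o v)
renameVar (keep o) zero     = zero
renameVar (keep o) (succ v) = succ (renameVar o v)

data NonEmpty : Ctx → Set where
  ty   : ∀ {Γ A} → NonEmpty (Γ , A)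
  lock : ∀ {Γ} → NonEmpty (Γ ,■)

NonEmpty-⊆ : ∀ {Γ Δ} → Γ ⊆ Δ → NonEmpty Γ → NonEmpty Δ
NonEmpty-⊆ (drop o)  _ = ty
NonEmpty-⊆ (keep o)  _ = ty
NonEmpty-⊆ (keep■ o) _ = lock

Factors : (Ctx → Ctx → Set) → Set
Factors _◁_ = ∀ {Δ Γ Γ′} → Δ ◁ Γ → Γ ⊆ Γ′ → ∃[ Δ′ ] Δ ⊆ Δ′ × Δ′ ◁ Γ′

factorK : Factors _◁K_
factorK e (drop o) with factorK e o
... | Δ′ & o′ & e′ = Δ′ & o′ & ext e′
factorK nil (keep■ o) = _ & o & nil
factorK (ext e) (keep o) with factorK e o
... | Δ′ & o′ & e′ = Δ′ & o′ & ext e′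

factorS : Factors _◁S_
factorS nil o = _ & o & nil
factorS e (drop o) with factorS e o
... | Δ′ & o′ & e′ = Δ′ & o′ & ext e′
factorS (ext e) (keep o) with factorS e o
... | Δ′ & o′ & e′ = Δ′ & o′ & ext e′
factorS (lock e) (keep■ o) with factorS e o
... | Δ′ & o′ & e′ = Δ′ & o′ & lock e′

◁K-nonEmpty : ∀ {Δ Γ} → Δ ◁K Γ → NonEmpty Δ → NonEmpty Γ
◁K-nonEmpty nil     _ = lock
◁K-nonEmpty (ext e) _ = ty

◁S-nonEmpty : ∀ {Δ Γ} → Δ ◁S Γ → NonEmpty Δ → NonEmpty Γ
◁S-nonEmpty nil      n = n
◁S-nonEmpty (ext e)  _ = ty
◁S-nonEmpty (lock e) _ = lock

◁S-trans : ∀ {Δ Θ Γ} → Δ ◁S Θ → Θ ◁S Γ → Δ ◁S Γ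
◁S-trans e nil       = e
◁S-trans e (ext e′)  = ext (◁S-trans e e′)
◁S-trans e (lock e′) = lock (◁S-trans e e′)

module NbE (_◁_ : Ctx → Ctx → Set)
           (restrict : ∀ {Δ Γ} → Δ ◁ Γ → Mark Γ → Mark Δ)
           (factor : Factors _◁_)
           (◁-nonEmpty : ∀ {Δ Γ} → Δ ◁ Γ → NonEmpty Δ → NonEmpty Γ)
           (◁-lock : ∀ {Γ} → Γ ◁ (Γ ,■)) where
  open Terms _◁_
  open Avoid _◁_ restrict

  rename : ∀ {Γ Γ′ A} → Γ ⊆ Γ′ → Tm Γ A → Tm Γ′ A
  rename o (var v)     = var (renameVar o v)
  rename o (lam t)     = lam (rename (keep o) t)
  rename o (app t u)   = app (rename o t) (rename o u)
  rename o (box t)     = box (rename (keep■ o) t)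
  rename o (unbox t e) with factor e o
  ... | _ & o′ & e′ = unbox (rename o′ t) e′

  data _◁ᵛ_ : Ctx → Ctx → Set where
    real    : ∀ {Δ Γ} → Δ ◁ Γ → Δ ◁ᵛ Γ
    virtual : ∀ {Γ} → · ◁ᵛ Γ

  factorᵛ : Factors _◁ᵛ_
  factorᵛ (real e) o with factor e o
  ... | Δ′ & o′ & e′ = Δ′ & o′ & real e′
  factorᵛ virtual o = · & base & virtual

  ⟦_⟧ : Ty → Ctx → Set
  ⟦ ι ⟧     Γ = Tm Γ ι
  ⟦ A ⇒ B ⟧ Γ = ∀ {Γ′} → Γ ⊆ Γ′ → ⟦ A ⟧ Γ′ → ⟦ B ⟧ Γ′
  ⟦ □ A ⟧   Γ = ∀ {Γ′ Δ} → Γ ⊆ Γ′ → Γ′ ◁ᵛ Δ → ⟦ A ⟧ Δ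

  ⟦_⟧-mono : ∀ A {Γ Γ′} → Γ ⊆ Γ′ → ⟦ A ⟧ Γ → ⟦ A ⟧ Γ′
  ⟦ ι ⟧-mono     o t     = rename o t
  ⟦ A ⇒ B ⟧-mono o f o′  = f (⊆-trans o o′)
  ⟦ □ A ⟧-mono   o f o′  = f (⊆-trans o o′)

  Env : ∀ {Γ} → Mark Γ → Ctx → Set
  Env []                        w = ⊤
  Env (m ∷ty true)              w = Env m w
  Env (_∷ty_ {A = A} m false)   w = Env m w × ⟦ A ⟧ w
  Env (m ∷■)                    w = ∃[ w′ ] w′ ◁ᵛ w × Env m w′

  Env-mono : ∀ {Γ} (m : Mark Γ) {w w′} → w ⊆ w′ → Env m w → Env m w′
  Env-mono []                      o ρ              = tt
  Env-mono (m ∷ty true)            o ρ              = Env-mono m o ρ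
  Env-mono (_∷ty_ {A = A} m false) o (ρ & a)        = Env-mono m o ρ & ⟦ A ⟧-mono o a
  Env-mono (m ∷■)                  o (_ & r & ρ) with factorᵛ r o
  ... | w′ & o′ & r′ = w′ & r′ & Env-mono m o′ ρ

  lookup : ∀ {Γ A} {m : Mark Γ} {v : Var Γ A} {w} → VarOK m v → Env m w → ⟦ A ⟧ w
  lookup zero                 (_ & a) = a
  lookup (succ {b = true} ok)  ρ      = lookup ok ρ
  lookup (succ {b = false} ok) (ρ & _) = lookup ok ρ

  reflect : ∀ A {Γ} → NonEmpty Γ → Tm Γ A → ⟦ A ⟧ Γ
  reify   : ∀ A {Γ} → ⟦ A ⟧ Γ → Tm Γ A
  reflect ι       n t = t
  reflect (A ⇒ B) n t o a =
    reflect B (NonEmpty-⊆ o n) (app (rename o t) (reify A a))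
  reflect (□ A)   n t o (real e) =
    reflect A (◁-nonEmpty e (NonEmpty-⊆ o n)) (unbox (rename o t) e)
  reflect (□ A)   () t base virtual
  reify ι       t = t
  reify (A ⇒ B) f = lam (reify B (f (drop ⊆-refl) (reflect A ty (var zero))))
  reify (□ A)   f = box (reify A (f ⊆-refl (real ◁-lock)))

  forbiddenEnv : ∀ Δ w → Env (uniform true Δ) w
  forbiddenEnv ·       w = tt
  forbiddenEnv (Δ , A) w = forbiddenEnv Δ w
  forbiddenEnv (Δ ,■)  w = · & virtual & forbiddenEnv Δ ·

  identityEnv : ∀ Δ Γ → Env (split Δ Γ) Γ
  identityEnv Δ ·       = forbiddenEnv Δ ·
  identityEnv Δ (Γ , A) =
    Env-mono (split Δ Γ) (drop ⊆-refl) (identityEnv Δ Γ) & reflect A ty (var zero)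
  identityEnv Δ (Γ ,■)  = Γ & real ◁-lock & identityEnv Δ Γ

  module Evaluation
    (restrictEnv : ∀ {Δ Γ w} (e : Δ ◁ Γ) (m : Mark Γ) → Env m w →
                   ∃[ w′ ] w′ ◁ᵛ w × Env (restrict e m) w′) where

    eval : ∀ {Γ A} {m : Mark Γ} {t : Tm Γ A} {w} → OK m t → Env m w → ⟦ A ⟧ w
    eval         (var ok)          ρ     = lookup ok ρ
    eval {m = m} (lam ok)          ρ o a = eval ok (Env-mono m o ρ & a)
    eval         (app ok ok′)      ρ     = eval ok ρ ⊆-refl (eval ok′ ρ)
    eval {m = m} (box ok)          ρ o r = eval ok (_ & r & Env-mono m o ρ)
    eval {m = m} (unbox {e = e} ok) ρ with restrictEnv e m ρ
    ... | _ & r & ρ′ = eval ok ρ′ ⊆-refl r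

    strengthen : (Δ Γ : Ctx) (A : Ty) (t : Tm (Δ ++ Γ) A) → OK (split Δ Γ) t → Tm Γ A
    strengthen Δ Γ A t ok = reify A (eval ok (identityEnv Δ Γ))

module NbEK = NbE _◁K_ restrictK factorK ◁K-nonEmpty nil
module NbES = NbE _◁S_ restrictS factorS ◁S-nonEmpty (lock nil)

restrictEnvK : ∀ {Δ Γ w} (e : Δ ◁K Γ) (m : Mark Γ) → NbEK.Env m w →
               ∃[ w′ ] NbEK._◁ᵛ_ w′ w × NbEK.Env (restrictK e m) w′
restrictEnvK nil     (m ∷■)        ρ       = ρ
restrictEnvK (ext e) (m ∷ty true)  ρ       = restrictEnvK e m ρ
restrictEnvK (ext e) (m ∷ty false) (ρ & _) = restrictEnvK e m ρ

◁ᵛS-trans : ∀ {Δ Θ Γ} → NbES._◁ᵛ_ Δ Θ → NbES._◁ᵛ_ Θ Γ → NbES._◁ᵛ_ Δ Γ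
◁ᵛS-trans (NbES.real e)   (NbES.real e′)  = NbES.real (◁S-trans e e′)
◁ᵛS-trans NbES.virtual    _               = NbES.virtual
◁ᵛS-trans (NbES.real nil) NbES.virtual    = NbES.virtual

restrictEnvS : ∀ {Δ Γ w} (e : Δ ◁S Γ) (m : Mark Γ) → NbES.Env m w →
               ∃[ w′ ] NbES._◁ᵛ_ w′ w × NbES.Env (restrictS e m) w′
restrictEnvS {w = w} nil m        ρ       = w & NbES.real nil & ρ
restrictEnvS (ext e)  (m ∷ty true)  ρ       = restrictEnvS e m ρ
restrictEnvS (ext e)  (m ∷ty false) (ρ & _) = restrictEnvS e m ρ
restrictEnvS (lock e) (m ∷■) (_ & r & ρ) with restrictEnvS e m ρ
... | w′ & r′ & ρ′ = w′ & ◁ᵛS-trans r′ r & ρ′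

lemma4p8 : ((Δ Γ : Ctx) (A : Ty) (t : TmK (Δ ++ Γ) A) → NoMentionK Δ Γ t → TmK Γ A)
    × ((Δ Γ : Ctx) (A : Ty) (t : TmS (Δ ++ Γ) A) → NoMentionS Δ Γ t → TmS Γ A)
lemma4p8 = NbEK.Evaluation.strengthen restrictEnvK & NbES.Evaluation.strengthen restrictEnvS
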